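{- Let $G$ be a tree on $n$ vertices with exactly $\frac{n-2}{2}$ vertices of degree $3$ and exactly $\frac{n+2}{2}$ vertices of degree $1$. If the line graph $\mathcal{L}(G)$ is isomorphic to $K^{ -1}(P_k)$ for some $k$, then $G$ is a centipede.
   Context: Graphs are finite, simple and undirected. The line graph $\mathcal{L}(G)$ has the edges of $G$ as vertices, two adjacent iff the corresponding edges share a vertex. $T$ denotes the triangle $K_3$ and $P_k$ the path on $k$ vertices. The set $\mathcal{T}$ is defined recursively: $T\in\mathcal{T}$, and if $H\in\mathcal{T}$, the graph obtained by identifying a vertex of degree $2$ of $H$ with a vertex of a new (disjoint) copy of $T$ belongs to $\mathcal{T}$. The clique graph $K(H)$ has as vertices the maximal complete subgraphs of $H$, two adjacent iff they share at least one vertex. $K^{ -1}(P_k)$ denotes the unique (up to isomorphism) graph $H\in\mathcal{T}$ with $K(H)\cong P_k$. A centipede is a tree obtained from a path by appending a pendant vertex to each vertex of degree $2$ of the path. -}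

module Defs where

open import Data.Nat using (ℕ; zero; suc; _+_; _*_; _∸_; _≡ᵇ_)
open import Data.Bool using (Bool; true; false; _∧_; _∨_; not; if_then_else_)
import Data.Bool.Properties as BoolP
open import Data.Fin using (Fin; toℕ; inject₁; fromℕ; _<_; _≟_)
import Data.Fin as F
open import Data.Fin.Subset using (Subset; _∈_; _⊆_)
open import Data.Vec using (lookup)
open import Data.Vec.Properties using (≡-dec)
open import Data.List using (List; allFin; map)
open import Data.Nat.ListAction using (sum)
open import Data.Bool.ListAction using (any)
open import Data.Sum using (_⊎_; inj₁; inj₂)
open import Data.Product using (Σ; _×_; ∃; ∃-syntax)
open import Relation.Nullary using (¬_; ⌊_⌋)
open import Relation.Binary.PropositionalEquality using (_≡_; _≢_)
open import Function.Definitions using (Injective)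

-- Graphs: a vertex type with a Boolean adjacency relation.
-- Simplicity (symmetry, irreflexivity) is imposed where needed
-- (it holds by construction for all graphs built below).

record Graph (V : Set) : Set where
  constructor graph
  field adj : V → V → Bool
open Graph public

Adj : ∀ {V} → Graph V → V → V → Set
Adj G u v = adj G u v ≡ true

IsSimple : ∀ {V} → Graph V → Set
IsSimple G = (∀ u v → adj G u v ≡ adj G v u) × (∀ v → adj G v v ≡ false)

record Iso {V W : Set} (G : Graph V) (H : Graph W) : Set where
  field
    to       : V → W
    from     : W → V
    from-to  : ∀ v → from (to v) ≡ v
    to-from  : ∀ w → to (from w) ≡ w
    preserve : ∀ u v → adj G u v ≡ adj H (to u) (to v)

countF : ∀ {n} → (Fin n → Bool) → ℕ
countF {n} p = sum (map (λ i → if p i then 1 else 0) (allFin n))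

anyF : ∀ {n} → (Fin n → Bool) → Bool
anyF {n} p = any p (allFin n)

deg : ∀ {n} → Graph (Fin n) → Fin n → ℕ
deg G v = countF (λ u → adj G v u)

numDeg : ∀ {n} → Graph (Fin n) → ℕ → ℕ
numDeg G d = countF (λ v → deg G v ≡ᵇ d)

data Walk {V : Set} (G : Graph V) : V → V → Set where
  here  : ∀ {v} → Walk G v v
  there : ∀ {u w v} → Adj G u w → Walk G w v → Walk G u v

Connected : ∀ {V} → Graph V → Set
Connected G = ∀ u v → Walk G u v

-- a cycle of length r + 3 : distinct vertices c 0, …, c (r+2),
-- consecutive ones adjacent, and c (r+2) adjacent to c 0
record Cycle {V : Set} (G : Graph V) (r : ℕ) : Set where
  field
    c      : Fin (3 + r) → V
    inj    : Injective _≡_ _≡_ c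
    steps  : ∀ (i : Fin (2 + r)) → Adj G (c (inject₁ i)) (c (F.suc i))
    closes : Adj G (c (fromℕ (2 + r))) (c F.zero)

Acyclic : ∀ {V} → Graph V → Set
Acyclic G = ∀ r → ¬ Cycle G r

IsTree : ∀ {V} → Graph V → Set
IsTree G = IsSimple G × Connected G × Acyclic G

_==_ : ∀ {n} → Fin n → Fin n → Bool
i == j = ⌊ i ≟ j ⌋

record Edge {n : ℕ} (G : Graph (Fin n)) : Set where
  constructor edge
  field
    a b     : Fin n
    .a<b    : a < b
    .isEdge : Adj G a b
open Edge

LineGraph : ∀ {n} (G : Graph (Fin n)) → Graph (Edge G)
LineGraph G = graph λ e f →
  not ((a e == a f) ∧ (b e == b f)) ∧
  ((a e == a f) ∨ (a e == b f) ∨ (b e == a f) ∨ (b e == b f))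

IsClique : ∀ {m} → Graph (Fin m) → Subset m → Set
IsClique H S = ∀ u v → u ∈ S → v ∈ S → u ≢ v → Adj H u v

-- maximal complete subgraph (identified with its vertex set)
IsMaxClique : ∀ {m} → Graph (Fin m) → Subset m → Set
IsMaxClique H S = IsClique H S × (∀ S' → IsClique H S' → S ⊆ S' → S' ⊆ S)

record MaxClique {m : ℕ} (H : Graph (Fin m)) : Set where
  constructor maxClique
  field
    set    : Subset m
    .isMax : IsMaxClique H set
open MaxClique

CliqueGraph : ∀ {m} (H : Graph (Fin m)) → Graph (MaxClique H)
CliqueGraph H = graph λ C D →
  not ⌊ ≡-dec BoolP._≟_ (set C) (set D) ⌋ ∧
  anyF (λ i → lookup (set C) i ∧ lookup (set D) i)

PathGraph : (k : ℕ) → Graph (Fin k)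
PathGraph k = graph λ i j → (suc (toℕ i) ≡ᵇ toℕ j) ∨ (suc (toℕ j) ≡ᵇ toℕ i)

Triangle : Graph (Fin 3)
Triangle = graph λ i j → not (i == j)

-- identify v with one vertex of a new triangle whose other two vertices
-- are inj₂ 0 and inj₂ 1
Glue : ∀ {m} → Graph (Fin m) → Fin m → Graph (Fin m ⊎ Fin 2)
Glue H v = graph ad
  where
  ad : _ → _ → Bool
  ad (inj₁ x) (inj₁ y) = adj H x y
  ad (inj₁ x) (inj₂ _) = x == v
  ad (inj₂ _) (inj₁ y) = y == v
  ad (inj₂ x) (inj₂ y) = not (x == y)

data InT : ∀ {m} → Graph (Fin m) → Set where
  base : ∀ {m} {H : Graph (Fin m)} → Iso H Triangle → InT H
  step : ∀ {m m'} {H : Graph (Fin m)} {H' : Graph (Fin m')} →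
         InT H → (v : Fin m) → deg H v ≡ 2 → Iso H' (Glue H v) → InT H'

-- Centipedes: spine path on p vertices (inj₁), pendant vertex inj₂ j
-- attached to spine vertex j+1, for each of the p ∸ 2 inner spine vertices

Centipede : (p : ℕ) → Graph (Fin p ⊎ Fin (p ∸ 2))
Centipede p = graph ad
  where
  ad : _ → _ → Bool
  ad (inj₁ i) (inj₁ j) = adj (PathGraph p) i j
  ad (inj₁ i) (inj₂ j) = toℕ i ≡ᵇ suc (toℕ j)
  ad (inj₂ j) (inj₁ i) = toℕ i ≡ᵇ suc (toℕ j)
  ad (inj₂ _) (inj₂ _) = false

IsCentipede : ∀ {V} → Graph V → Set
IsCentipede G = ∃[ p ] Iso G (Centipede p)

-- Proposition 4.  Let G be a tree on n vertices with (n-2)/2 vertices of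
-- degree 3 and (n+2)/2 vertices of degree 1.  If the line graph L(G) is
-- isomorphic to a graph H whose clique graph K(H) is a path P_k, then G is
-- a centipede.
--
-- The two degree counts add up to n, so every vertex is a leaf
-- (degree 1) or internal (degree 3).  Without internal vertices G = K₂,
-- the centipede with two spine vertices.  Otherwise no two leaves are
-- adjacent and G has no triangle, so the maximal cliques of L(G) ≅ H are
-- exactly the stars (sets of incident edges) of the internal vertices, and
-- two such stars meet iff their centres are adjacent.  Thus K(H) ≅ P_k is
-- the subgraph of G induced by the internal vertices: they form a path
-- c₀ … c_{k-1}.  Sending c_i to spine vertex i+1 and every leaf to a free
-- slot of its neighbour (the pendant of c_i, or the spine ends 0 and k+1
-- at c₀ and c_{k-1}) embeds G into Centipede (k+2), which has 2k+2 ≤ n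
-- vertices; an injection between finite sets of these sizes is onto.
module Submission where

open import Defs
open import Data.Nat as N using (ℕ; zero; suc; _+_; _*_; _≡ᵇ_; z≤n; s≤s)
import Data.Nat.Properties as NP
open import Data.Nat.Solver using (module +-*-Solver)
open import Data.Bool using (Bool; true; false; _∧_; _∨_; not; if_then_else_)
import Data.Bool.Properties as BP
open import Data.Fin as F using (Fin; toℕ; inject₁; fromℕ; _≟_)
import Data.Fin.Properties as FP
open import Data.Maybe using (Maybe; just; nothing)
import Data.Maybe as M
open import Data.List using (tabulate)
import Data.List.Properties as LP
open import Data.Nat.ListAction using (sum)
import Data.Bool.ListAction as BL
open import Data.Sum using (_⊎_; inj₁; inj₂)
open import Data.Sum.Properties using (inj₁-injective; inj₂-injective)
open import Data.Product using (Σ; _×_; _,_; proj₁; proj₂)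
open import Data.Empty using (⊥; ⊥-elim)
open import Relation.Nullary using (¬_; yes; no; Dec)
open import Relation.Nullary.Decidable using (recompute; _×-dec_)
open import Relation.Binary using (tri<; tri≈; tri>)
open import Data.Fin.Subset using (Subset; _∈_; _⊆_; ⁅_⁆)
import Data.Fin.Subset.Properties as SP
import Data.Vec as V
import Data.Vec.Properties as VP
open import Relation.Binary.PropositionalEquality
open import Function using (id)

true≢false : true ≢ false
true≢false ()

∧-true₁ : ∀ {a b} → a ∧ b ≡ true → a ≡ true
∧-true₁ {true} _ = refl

∧-true₂ : ∀ {a b} → a ∧ b ≡ true → b ≡ true
∧-true₂ {true} e = e

∧-intro : ∀ {a b} → a ≡ true → b ≡ true → a ∧ b ≡ true
∧-intro refl refl = refl

∧-false₂ : ∀ {a b} → a ≡ true → a ∧ b ≡ false → b ≡ false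
∧-false₂ refl h = h

∨-introˡ : ∀ {a b} → a ≡ true → a ∨ b ≡ true
∨-introˡ refl = refl

∨-introʳ : ∀ a {b} → b ≡ true → a ∨ b ≡ true
∨-introʳ a refl = BP.∨-zeroʳ a

not-intro : ∀ {a} → a ≡ false → not a ≡ true
not-intro refl = refl

false-intro : ∀ {a} → ¬ (a ≡ true) → a ≡ false
false-intro {true} h = ⊥-elim (h refl)
false-intro {false} _ = refl

bool-ext : ∀ {a b} → (a ≡ true → b ≡ true) → (b ≡ true → a ≡ true) → a ≡ b
bool-ext {true} f g = sym (f refl)
bool-ext {false} {true} f g = g refl
bool-ext {false} {false} f g = refl

if-true : ∀ {X : Set} {b} (x y : X) → b ≡ true → (if b then x else y) ≡ x
if-true x y refl = refl

if-false : ∀ {X : Set} {b} (x y : X) → b ≡ false → (if b then x else y) ≡ y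
if-false x y refl = refl

==⇒≡ : ∀ {n} {i j : Fin n} → i == j ≡ true → i ≡ j
==⇒≡ {i = i} {j} eq with i ≟ j
... | yes p = p
... | no _ = ⊥-elim (true≢false (sym eq))

≡⇒== : ∀ {n} {i j : Fin n} → i ≡ j → i == j ≡ true
≡⇒== {i = i} refl with i ≟ i
... | yes _ = refl
... | no q = ⊥-elim (q refl)

≢⇒== : ∀ {n} {i j : Fin n} → i ≢ j → i == j ≡ false
≢⇒== {i = i} {j} ne with i ≟ j
... | yes p = ⊥-elim (ne p)
... | no _ = refl

==⇒≢ : ∀ {n} {i j : Fin n} → i == j ≡ false → i ≢ j
==⇒≢ eq e = true≢false (trans (sym (≡⇒== e)) eq)

==-suc : ∀ {n} (i j : Fin n) → (F.suc i == F.suc j) ≡ (i == j)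
==-suc i j with i ≟ j
... | yes refl = refl
... | no _ = refl

≡ᵇ⇒≡ : ∀ {a b} → (a ≡ᵇ b) ≡ true → a ≡ b
≡ᵇ⇒≡ {zero} {zero} _ = refl
≡ᵇ⇒≡ {suc a} {suc b} h = cong suc (≡ᵇ⇒≡ h)

≡⇒≡ᵇ : ∀ {a b} → a ≡ b → (a ≡ᵇ b) ≡ true
≡⇒≡ᵇ {zero} refl = refl
≡⇒≡ᵇ {suc a} refl = ≡⇒≡ᵇ {a} refl

≢⇒≡ᵇ : ∀ {a b} → a ≢ b → (a ≡ᵇ b) ≡ false
≢⇒≡ᵇ ne = false-intro (λ h → ne (≡ᵇ⇒≡ h))

≡ᵇ-sym : ∀ a b → (a ≡ᵇ b) ≡ (b ≡ᵇ a)
≡ᵇ-sym a b = bool-ext (λ h → ≡⇒≡ᵇ (sym (≡ᵇ⇒≡ {a} h)))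
                      (λ h → ≡⇒≡ᵇ (sym (≡ᵇ⇒≡ {b} h)))

count : ∀ {n} → (Fin n → Bool) → ℕ
count {zero} p = 0
count {suc n} p = (if p F.zero then 1 else 0) + count (λ i → p (F.suc i))

countF≡count : ∀ {n} (p : Fin n → Bool) → countF p ≡ count p
countF≡count {n} p =
  trans (cong sum (LP.map-tabulate id (λ i → if p i then 1 else 0))) (sum-tabulate p)
  where
  sum-tabulate : ∀ {n} (p : Fin n → Bool) →
                 sum (tabulate (λ i → if p i then 1 else 0)) ≡ count p
  sum-tabulate {zero} p = refl
  sum-tabulate {suc n} p = cong ((if p F.zero then 1 else 0) +_) (sum-tabulate (λ i → p (F.suc i)))

count-ext : ∀ {n} {p q : Fin n → Bool} → (∀ x → p x ≡ q x) → count p ≡ count q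
count-ext {zero} h = refl
count-ext {suc n} h =
  cong₂ _+_ (cong (λ b → if b then 1 else 0) (h F.zero)) (count-ext (λ x → h (F.suc x)))

count≤ : ∀ {n} (p : Fin n → Bool) → count p N.≤ n
count≤ {zero} p = z≤n
count≤ {suc n} p with p F.zero
... | true = s≤s (count≤ (λ i → p (F.suc i)))
... | false = NP.m≤n⇒m≤1+n (count≤ (λ i → p (F.suc i)))

count< : ∀ {n} (p : Fin n → Bool) (x : Fin n) → p x ≡ false → count p N.< n
count< {suc n} p F.zero px rewrite px = s≤s (count≤ (λ i → p (F.suc i)))
count< {suc n} p (F.suc x) px with p F.zero
... | true = s≤s (count< (λ i → p (F.suc i)) x px)
... | false = NP.m≤n⇒m≤1+n (count< (λ i → p (F.suc i)) x px)

count-∨ : ∀ {n} (p q : Fin n → Bool) → (∀ x → p x ∧ q x ≡ false) →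
          count p + count q ≡ count (λ x → p x ∨ q x)
count-∨ {zero} p q h = refl
count-∨ {suc n} p q h
  with p F.zero | q F.zero | h F.zero
     | count-∨ (λ i → p (F.suc i)) (λ i → q (F.suc i)) (λ i → h (F.suc i))
... | true | false | _ | ih = cong suc ih
... | false | true | _ | ih = trans (NP.+-suc (count (λ i → p (F.suc i))) _) (cong suc ih)
... | false | false | _ | ih = ih

remove : ∀ {n} → (Fin n → Bool) → Fin n → Fin n → Bool
remove p x y = p y ∧ not (y == x)

remove-keeps : ∀ {n} (p : Fin n → Bool) {x y} → p y ≡ true → y ≢ x → remove p x y ≡ true
remove-keeps p {x} {y} py ne rewrite py | ≢⇒== ne = refl

remove-≢ : ∀ {n} (p : Fin n → Bool) {x y} → remove p x y ≡ true → y ≢ x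
remove-≢ p {x} {y} h refl rewrite ≡⇒== (refl {x = x}) | BP.∧-zeroʳ (p x) = true≢false (sym h)

remove-⊆ : ∀ {n} (p : Fin n → Bool) {x y} → remove p x y ≡ true → p y ≡ true
remove-⊆ p h = ∧-true₁ h

count-remove : ∀ {n} (p : Fin n → Bool) (x : Fin n) → p x ≡ true →
               count p ≡ suc (count (remove p x))
count-remove {suc n} p F.zero px rewrite px =
  cong suc (count-ext (λ y → sym (BP.∧-identityʳ (p (F.suc y)))))
count-remove {suc n} p (F.suc x) px
  rewrite count-remove (λ i → p (F.suc i)) x px | BP.∧-identityʳ (p F.zero) =
  trans (NP.+-suc (if p F.zero then 1 else 0) _)
    (cong (λ c → suc ((if p F.zero then 1 else 0) + c))
      (count-ext (λ y → cong (λ b → p (F.suc y) ∧ not b) (sym (==-suc y x)))))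

count-remove-pred : ∀ {n} (p : Fin n → Bool) {x m} → p x ≡ true → count p ≡ suc m →
                    count (remove p x) ≡ m
count-remove-pred p {x} px c = NP.suc-injective (trans (sym (count-remove p x px)) c)

count0-empty : ∀ {n} (p : Fin n → Bool) {x} → count p ≡ 0 → p x ≡ true → ⊥
count0-empty p {x} c px = NP.1+n≢0 (trans (sym (count-remove p x px)) c)

first : ∀ {n} → (Fin n → Bool) → Maybe (Fin n)
first {zero} p = nothing
first {suc n} p = if p F.zero then just F.zero else M.map F.suc (first (λ i → p (F.suc i)))

first-just : ∀ {n} (p : Fin n → Bool) {x} → first p ≡ just x → p x ≡ true
first-just {suc n} p eq with p F.zero in e0
first-just {suc n} p refl | true = e0
... | false with first (λ i → p (F.suc i)) in e1
first-just {suc n} p refl | false | just y = first-just (λ i → p (F.suc i)) e1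

first-nothing : ∀ {n} (p : Fin n → Bool) → first p ≡ nothing → ∀ x → p x ≡ false
first-nothing {suc n} p eq x with p F.zero in e0
first-nothing {suc n} p () x | true
... | false with first (λ i → p (F.suc i)) in e1
first-nothing {suc n} p refl F.zero | false | nothing = e0
first-nothing {suc n} p refl (F.suc x) | false | nothing =
  first-nothing (λ i → p (F.suc i)) e1 x

pick : ∀ {n} → (Fin n → Bool) → Fin n → Fin n
pick p d = M.fromMaybe d (first p)

pick-spec : ∀ {n} (p : Fin n → Bool) d {x} → p x ≡ true → p (pick p d) ≡ true
pick-spec p d {x} px with first p in e
... | just y = first-just p e
... | nothing = ⊥-elim (true≢false (trans (sym px) (first-nothing p e x)))

count-witness : ∀ {n} (p : Fin n → Bool) {m} → count p ≡ suc m → Σ (Fin n) λ x → p x ≡ true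
count-witness p c with first p in e
... | just y = y , first-just p e
... | nothing = ⊥-elim (NP.1+n≢0 (trans (sym c) (count-none p (first-nothing p e))))
  where
  count-none : ∀ {n} (p : Fin n → Bool) → (∀ x → p x ≡ false) → count p ≡ 0
  count-none {zero} p h = refl
  count-none {suc n} p h rewrite h F.zero = count-none (λ i → p (F.suc i)) (λ i → h (F.suc i))

count1-unique : ∀ {n} (p : Fin n → Bool) {x y} → count p ≡ 1 →
                p x ≡ true → p y ≡ true → y ≡ x
count1-unique p {x} {y} c px py with y ≟ x
... | yes e = e
... | no ne = ⊥-elim (count0-empty (remove p x) (count-remove-pred p px c) (remove-keeps p py ne))

count3-no-four : ∀ {n} (p : Fin n → Bool) {a b c d} → count p ≡ 3 →
  p a ≡ true → p b ≡ true → p c ≡ true → p d ≡ true →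
  b ≢ a → c ≢ a → c ≢ b → d ≢ a → d ≢ b → d ≢ c → ⊥
count3-no-four p {a} {b} {c} {d} h pa pb pc pd ba ca cb da db dc =
  count0-empty p₃ (count-remove-pred p₂ (remove-keeps p₁ (remove-keeps p pc ca) cb)
                    (count-remove-pred p₁ (remove-keeps p pb ba) (count-remove-pred p pa h)))
    (remove-keeps p₂ (remove-keeps p₁ (remove-keeps p pd da) db) dc)
  where
  p₁ p₂ p₃ : Fin _ → Bool
  p₁ = remove p a
  p₂ = remove p₁ b
  p₃ = remove p₂ c

record Three {n} (p : Fin n → Bool) : Set where
  field
    x₁ x₂ x₃ : Fin n
    p₁ : p x₁ ≡ true
    p₂ : p x₂ ≡ true
    p₃ : p x₃ ≡ true
    x₂≢x₁ : x₂ ≢ x₁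
    x₃≢x₁ : x₃ ≢ x₁
    x₃≢x₂ : x₃ ≢ x₂

three : ∀ {n} (p : Fin n → Bool) → count p ≡ 3 → Three p
three p h with count-witness p h
... | a , pa with count-witness (remove p a) (count-remove-pred p pa h)
... | b , pb with count-witness (remove (remove p a) b)
                   (count-remove-pred (remove p a) pb (count-remove-pred p pa h))
... | c , pc = record
  { x₁ = a ; x₂ = b ; x₃ = c
  ; p₁ = pa ; p₂ = remove-⊆ p pb ; p₃ = remove-⊆ p (remove-⊆ (remove p a) pc)
  ; x₂≢x₁ = remove-≢ p pb ; x₃≢x₁ = remove-≢ p (remove-⊆ (remove p a) pc)
  ; x₃≢x₂ = remove-≢ (remove p a) pc }

count-injective : ∀ {n k} (p : Fin n → Bool) (f : Fin k → Fin n) →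
                  (∀ {i j} → f i ≡ f j → i ≡ j) → (∀ i → p (f i) ≡ true) →
                  k N.≤ count p
count-injective {k = zero} p f inj pf = z≤n
count-injective {k = suc k} p f inj pf =
  subst (suc k N.≤_) (sym (count-remove p (f F.zero) (pf F.zero)))
    (s≤s (count-injective (remove p (f F.zero)) (λ i → f (F.suc i)) (λ e → FP.suc-injective (inj e))
      (λ i → remove-keeps p (pf (F.suc i)) (λ e → FP.0≢1+n (sym (inj e))))))

injective⇒onto : ∀ {a b} (f : Fin a → Fin b) → (∀ {x y} → f x ≡ f y → x ≡ y) →
                 b N.≤ a →
                 ∀ y → Σ (Fin a) λ x → f x ≡ y
injective⇒onto {a} {suc b} f inj le y with FP.any? (λ x → f x ≟ y)
... | yes found = found
... | no missed with FP.pigeonhole le (λ x → F.punchOut {i = y} {j = f x} (λ e → missed (x , sym e)))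
... | i , j , i<j , e =
  ⊥-elim (FP.<-irrefl (inj (FP.punchOut-injective (λ e' → missed (i , sym e'))
                                                   (λ e' → missed (j , sym e')) e)) i<j)

injection⇒iso : ∀ {n a b} (G : Graph (Fin n)) (H : Graph (Fin a ⊎ Fin b))
  (f : Fin n → Fin a ⊎ Fin b) → (∀ {x y} → f x ≡ f y → x ≡ y) → a + b N.≤ n →
  (∀ u v → adj G u v ≡ adj H (f u) (f v)) → Iso G H
injection⇒iso {a = a} {b} G H f f-injective a+b≤n preserve = record
  { to = f ; from = from ; from-to = from-to ; to-from = to-from ; preserve = preserve }
  where
  code : Fin a ⊎ Fin b → Fin (a + b)
  code = F.join a b
  code-injective : ∀ {x y} → code x ≡ code y → x ≡ y
  code-injective {x} {y} e =
    trans (sym (FP.splitAt-join a b x)) (trans (cong (F.splitAt a) e) (FP.splitAt-join a b y))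
  onto : ∀ w → Σ (Fin _) λ x → code (f x) ≡ w
  onto = injective⇒onto (λ x → code (f x)) (λ e → f-injective (code-injective e)) a+b≤n
  from : Fin a ⊎ Fin b → Fin _
  from w = proj₁ (onto (code w))
  to-from : ∀ w → f (from w) ≡ w
  to-from w = code-injective (proj₂ (onto (code w)))
  from-to : ∀ x → from (f x) ≡ x
  from-to x = f-injective (to-from (f x))

anyFin : ∀ {n} → (Fin n → Bool) → Bool
anyFin {zero} p = false
anyFin {suc n} p = p F.zero ∨ anyFin (λ i → p (F.suc i))

anyF≡anyFin : ∀ {n} (p : Fin n → Bool) → anyF p ≡ anyFin p
anyF≡anyFin p = trans (cong BL.or (LP.map-tabulate id p)) (or-tabulate p)
  where
  or-tabulate : ∀ {n} (p : Fin n → Bool) → BL.or (tabulate p) ≡ anyFin p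
  or-tabulate {zero} p = refl
  or-tabulate {suc n} p = cong (p F.zero ∨_) (or-tabulate (λ i → p (F.suc i)))

anyF-intro : ∀ {n} (p : Fin n → Bool) x → p x ≡ true → anyF p ≡ true
anyF-intro p x px = trans (anyF≡anyFin p) (go p x px)
  where
  go : ∀ {n} (p : Fin n → Bool) x → p x ≡ true → anyFin p ≡ true
  go p F.zero px = ∨-introˡ px
  go p (F.suc x) px = ∨-introʳ (p F.zero) (go (λ i → p (F.suc i)) x px)

anyF-elim : ∀ {n} (p : Fin n → Bool) → anyF p ≡ true → Σ (Fin n) λ x → p x ≡ true
anyF-elim p h = go p (trans (sym (anyF≡anyFin p)) h)
  where
  go : ∀ {n} (p : Fin n → Bool) → anyFin p ≡ true → Σ (Fin n) λ x → p x ≡ true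
  go {suc n} p h with p F.zero in e
  ... | true = F.zero , e
  ... | false with go (λ i → p (F.suc i)) h
  ... | x , px = F.suc x , px

degree-counts-sum : ∀ {a b n} → 2 * a + 2 ≡ n → 2 * b ≡ n + 2 → b + a ≡ n
degree-counts-sum {a} {b} e3 e1 = trans (cong (_+ a) b≡a+2) (trans (a+2+a a) e3)
  where
  open +-*-Solver
  a+2+a : ∀ a → (a + 2) + a ≡ 2 * a + 2
  a+2+a = solve 1 (λ a → (a :+ con 2) :+ a := con 2 :* a :+ con 2) refl
  2a+4 : ∀ a → (2 * a + 2) + 2 ≡ 2 * (a + 2)
  2a+4 = solve 1 (λ a → (con 2 :* a :+ con 2) :+ con 2 := con 2 :* (a :+ con 2)) refl
  b≡a+2 : b ≡ a + 2
  b≡a+2 = NP.*-cancelˡ-≡ b (a + 2) 2 (trans e1 (trans (cong (_+ 2) (sym e3)) (2a+4 a)))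

degree-1-or-3 : ∀ {n} (G : Graph (Fin n)) → 2 * numDeg G 3 + 2 ≡ n → 2 * numDeg G 1 ≡ n + 2 →
                ∀ v → deg G v ≡ 1 ⊎ deg G v ≡ 3
degree-1-or-3 {n} G e3 e1 v with deg G v ≡ᵇ 1 in is1 | deg G v ≡ᵇ 3 in is3
... | true | _ = inj₁ (≡ᵇ⇒≡ is1)
... | false | true = inj₂ (≡ᵇ⇒≡ is3)
... | false | false =
  ⊥-elim (NP.<-irrefl all-counted
            (count< (λ x → deg1 x ∨ deg3 x) v (trans (cong (_∨ deg3 v) is1) is3)))
  where
  deg1 deg3 : Fin n → Bool
  deg1 x = deg G x ≡ᵇ 1
  deg3 x = deg G x ≡ᵇ 3
  disjoint : ∀ x → deg1 x ∧ deg3 x ≡ false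
  disjoint x with deg G x ≡ᵇ 1 in r
  ... | false = refl
  ... | true rewrite ≡ᵇ⇒≡ {deg G x} r = refl
  all-counted : count (λ x → deg1 x ∨ deg3 x) ≡ n
  all-counted = begin
    count (λ x → deg1 x ∨ deg3 x) ≡⟨ count-∨ deg1 deg3 disjoint ⟨
    count deg1 + count deg3       ≡⟨ cong₂ _+_ (countF≡count deg1) (countF≡count deg3) ⟨
    numDeg G 1 + numDeg G 3       ≡⟨ degree-counts-sum {numDeg G 3} {numDeg G 1} e3 e1 ⟩
    n                             ∎
    where open ≡-Reasoning

two-vertex-centipede : ∀ (G : Graph (Fin 2)) → IsSimple G → Connected G → IsCentipede G
two-vertex-centipede G (symA , irrA) conn =
  2 , record { to = inj₁ ; from = from ; from-to = λ _ → refl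
             ; to-from = to-from ; preserve = preserve }
  where
  from : Fin 2 ⊎ Fin 0 → Fin 2
  from (inj₁ x) = x
  to-from : ∀ w → inj₁ (from w) ≡ w
  to-from (inj₁ x) = refl
  edge01 : adj G F.zero (F.suc F.zero) ≡ true
  edge01 with conn F.zero (F.suc F.zero)
  ... | there {w = F.zero} h _ = ⊥-elim (true≢false (trans (sym h) (irrA F.zero)))
  ... | there {w = F.suc F.zero} h _ = h
  preserve : ∀ u v → adj G u v ≡ adj (Centipede 2) (inj₁ u) (inj₁ v)
  preserve F.zero F.zero = irrA F.zero
  preserve F.zero (F.suc F.zero) = edge01
  preserve (F.suc F.zero) F.zero = trans (symA _ _) edge01
  preserve (F.suc F.zero) (F.suc F.zero) = irrA (F.suc F.zero)

module Tree {n : ℕ} (G : Graph (Fin n))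
  (symA : ∀ u v → adj G u v ≡ adj G v u) (irrA : ∀ v → adj G v v ≡ false)
  (conn : Connected G) (acyc : Acyclic G)
  (degs : ∀ v → deg G v ≡ 1 ⊎ deg G v ≡ 3)
  (v₀ : Fin n) (v₀-internal : deg G v₀ ≡ 3) where

  A : Fin n → Fin n → Set
  A = Adj G

  A-sym : ∀ {u v} → A u v → A v u
  A-sym {u} {v} h = trans (symA v u) h

  A-≢ : ∀ {u v} → A u v → u ≢ v
  A-≢ {u} h refl = true≢false (trans (sym h) (irrA u))

  Leaf Internal : Fin n → Set
  Leaf v = deg G v ≡ 1
  Internal v = deg G v ≡ 3

  leaf≢internal : ∀ {u v} → Leaf u → Internal v → u ≢ v
  leaf≢internal l i refl with trans (sym l) i
  ... | ()

  leaf-if-not-internal : ∀ {u} → ¬ Internal u → Leaf u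
  leaf-if-not-internal {u} ni with degs u
  ... | inj₁ l = l
  ... | inj₂ i = ⊥-elim (ni i)

  deg≡count : ∀ v → deg G v ≡ count (adj G v)
  deg≡count v = countF≡count (adj G v)

  leaf-neighbour-unique : ∀ {u x y} → Leaf u → A u x → A u y → y ≡ x
  leaf-neighbour-unique {u} l = count1-unique (adj G u) (trans (sym (deg≡count u)) l)

  neighbours : ∀ {v} → Internal v → Three (adj G v)
  neighbours {v} i = three (adj G v) (trans (sym (deg≡count v)) i)

  no-four-neighbours : ∀ {v a b c d} → Internal v → A v a → A v b → A v c → A v d →
    b ≢ a → c ≢ a → c ≢ b → d ≢ a → d ≢ b → d ≢ c → ⊥
  no-four-neighbours {v} i = count3-no-four (adj G v) (trans (sym (deg≡count v)) i)

  nbr : Fin n → Fin n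
  nbr u = pick (adj G u) u

  nbr-adj : ∀ {u} → Leaf u → A u (nbr u)
  nbr-adj {u} l = pick-spec (adj G u) u (proj₂ (count-witness (adj G u) (trans (sym (deg≡count u)) l)))

  -- two adjacent leaves form a connected component on their own ...
  leaf-edge-closed : ∀ {x y} → Leaf x → Leaf y → A x y →
                     ∀ {u v} → Walk G u v → (u ≡ x ⊎ u ≡ y) → (v ≡ x ⊎ v ≡ y)
  leaf-edge-closed lx ly xy here p = p
  leaf-edge-closed lx ly xy (there a w) (inj₁ refl) =
    leaf-edge-closed lx ly xy w (inj₂ (leaf-neighbour-unique lx xy a))
  leaf-edge-closed lx ly xy (there a w) (inj₂ refl) =
    leaf-edge-closed lx ly xy w (inj₁ (leaf-neighbour-unique ly (A-sym xy) a))

  -- ... which cannot contain the internal vertex v₀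
  no-leaf-edge : ∀ {x y} → Leaf x → Leaf y → A x y → ⊥
  no-leaf-edge {x} lx ly xy with leaf-edge-closed lx ly xy (conn x v₀) (inj₁ refl)
  ... | inj₁ e = leaf≢internal lx v₀-internal (sym e)
  ... | inj₂ e = leaf≢internal ly v₀-internal (sym e)

  nbr-internal : ∀ {u} → Leaf u → Internal (nbr u)
  nbr-internal {u} l with degs (nbr u)
  ... | inj₂ i = i
  ... | inj₁ l' = ⊥-elim (no-leaf-edge l l' (nbr-adj l))

  no-triangle : ∀ {x y z} → A x y → A y z → A z x → ⊥
  no-triangle {x} {y} {z} xy yz zx = acyc 0 (record { c = c ; inj = inj ; steps = steps ; closes = zx })
    where
    c : Fin 3 → Fin n
    c F.zero = x
    c (F.suc F.zero) = y
    c (F.suc (F.suc F.zero)) = z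
    inj : ∀ {i j} → c i ≡ c j → i ≡ j
    inj {F.zero} {F.zero} e = refl
    inj {F.zero} {F.suc F.zero} e = ⊥-elim (A-≢ xy e)
    inj {F.zero} {F.suc (F.suc F.zero)} e = ⊥-elim (A-≢ zx (sym e))
    inj {F.suc F.zero} {F.zero} e = ⊥-elim (A-≢ xy (sym e))
    inj {F.suc F.zero} {F.suc F.zero} e = refl
    inj {F.suc F.zero} {F.suc (F.suc F.zero)} e = ⊥-elim (A-≢ yz e)
    inj {F.suc (F.suc F.zero)} {F.zero} e = ⊥-elim (A-≢ zx e)
    inj {F.suc (F.suc F.zero)} {F.suc F.zero} e = ⊥-elim (A-≢ yz (sym e))
    inj {F.suc (F.suc F.zero)} {F.suc (F.suc F.zero)} e = refl
    steps : ∀ (i : Fin 2) → A (c (inject₁ i)) (c (F.suc i))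
    steps F.zero = xy
    steps (F.suc F.zero) = yz

  E : Set
  E = Edge G

  end₁ end₂ : E → Fin n
  end₁ = Edge.a
  end₂ = Edge.b

  ends-adj : (e : E) → A (end₁ e) (end₂ e)
  ends-adj (edge a b _ h) = recompute (adj G a b BP.≟ true) h

  edge-ext : ∀ {e f : E} → end₁ e ≡ end₁ f → end₂ e ≡ end₂ f → e ≡ f
  edge-ext {edge a b _ _} {edge .a .b _ _} refl refl = refl

  mkEdge : (x y : Fin n) → A x y → E
  mkEdge x y h with FP.<-cmp x y
  ... | tri< lt _ _ = edge x y lt h
  ... | tri≈ _ e _ = ⊥-elim (A-≢ h e)
  ... | tri> _ _ gt = edge y x gt (A-sym h)

  mkEdge-ends : ∀ x y h → (end₁ (mkEdge x y h) ≡ x × end₂ (mkEdge x y h) ≡ y)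
                        ⊎ (end₁ (mkEdge x y h) ≡ y × end₂ (mkEdge x y h) ≡ x)
  mkEdge-ends x y h with FP.<-cmp x y
  ... | tri< _ _ _ = inj₁ (refl , refl)
  ... | tri≈ _ e _ = ⊥-elim (A-≢ h e)
  ... | tri> _ _ _ = inj₂ (refl , refl)

  inc : Fin n → E → Bool
  inc v e = (end₁ e == v) ∨ (end₂ e == v)

  inc-intro : ∀ {v} e → end₁ e ≡ v ⊎ end₂ e ≡ v → inc v e ≡ true
  inc-intro e (inj₁ e₁) = ∨-introˡ (≡⇒== e₁)
  inc-intro e (inj₂ e₂) = ∨-introʳ (end₁ e == _) (≡⇒== e₂)

  inc-elim : ∀ {v} e → inc v e ≡ true → end₁ e ≡ v ⊎ end₂ e ≡ v
  inc-elim {v} e h with end₁ e == v in e₁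
  ... | true = inj₁ (==⇒≡ e₁)
  ... | false = inj₂ (==⇒≡ h)

  inc-end₁ : ∀ e → inc (end₁ e) e ≡ true
  inc-end₁ e = inc-intro e (inj₁ refl)

  inc-end₂ : ∀ e → inc (end₂ e) e ≡ true
  inc-end₂ e = inc-intro e (inj₂ refl)

  mkEdge-inc₁ : ∀ x y h → inc x (mkEdge x y h) ≡ true
  mkEdge-inc₁ x y h with mkEdge-ends x y h
  ... | inj₁ (e₁ , _) = inc-intro (mkEdge x y h) (inj₁ e₁)
  ... | inj₂ (_ , e₂) = inc-intro (mkEdge x y h) (inj₂ e₂)

  mkEdge-inc₂ : ∀ x y h → inc y (mkEdge x y h) ≡ true
  mkEdge-inc₂ x y h with mkEdge-ends x y h
  ... | inj₁ (_ , e₂) = inc-intro (mkEdge x y h) (inj₂ e₂)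
  ... | inj₂ (e₁ , _) = inc-intro (mkEdge x y h) (inj₁ e₁)

  mkEdge-inc-elim : ∀ {p x y h} → inc p (mkEdge x y h) ≡ true → p ≡ x ⊎ p ≡ y
  mkEdge-inc-elim {p} {x} {y} {h} i with inc-elim (mkEdge x y h) i | mkEdge-ends x y h
  ... | inj₁ e₁ | inj₁ (a , _) = inj₁ (trans (sym e₁) a)
  ... | inj₁ e₁ | inj₂ (a , _) = inj₂ (trans (sym e₁) a)
  ... | inj₂ e₂ | inj₁ (_ , b) = inj₂ (trans (sym e₂) b)
  ... | inj₂ e₂ | inj₂ (_ , b) = inj₁ (trans (sym e₂) b)

  other-end : ∀ {z} e → inc z e ≡ true → Σ (Fin n) λ q → A z q × inc q e ≡ true
  other-end e h with inc-elim e h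
  ... | inj₁ refl = end₂ e , ends-adj e , inc-end₂ e
  ... | inj₂ refl = end₁ e , A-sym (ends-adj e) , inc-end₁ e

  inc-both-adj : ∀ {v w} e → inc v e ≡ true → inc w e ≡ true → v ≢ w → A v w
  inc-both-adj e hv hw ne with inc-elim e hv | inc-elim e hw
  ... | inj₁ refl | inj₁ refl = ⊥-elim (ne refl)
  ... | inj₁ refl | inj₂ refl = ends-adj e
  ... | inj₂ refl | inj₁ refl = A-sym (ends-adj e)
  ... | inj₂ refl | inj₂ refl = ⊥-elim (ne refl)

  two-ends : ∀ {p q r} e → inc p e ≡ true → inc q e ≡ true → p ≢ q → inc r e ≡ true →
             r ≡ p ⊎ r ≡ q
  two-ends e hp hq ne hr with inc-elim e hp | inc-elim e hq | inc-elim e hr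
  ... | inj₁ refl | inj₁ refl | _ = ⊥-elim (ne refl)
  ... | inj₂ refl | inj₂ refl | _ = ⊥-elim (ne refl)
  ... | inj₁ refl | inj₂ refl | inj₁ refl = inj₁ refl
  ... | inj₁ refl | inj₂ refl | inj₂ refl = inj₂ refl
  ... | inj₂ refl | inj₁ refl | inj₁ refl = inj₂ refl
  ... | inj₂ refl | inj₁ refl | inj₂ refl = inj₁ refl

  no-three-ends : ∀ {p q r} e → inc p e ≡ true → inc q e ≡ true → inc r e ≡ true →
                  q ≢ p → r ≢ p → r ≢ q → ⊥
  no-three-ends e hp hq hr qp rp rq with two-ends e hp hq (λ x → qp (sym x)) hr
  ... | inj₁ x = rp x
  ... | inj₂ x = rq x

  L : E → E → Bool
  L = adj (LineGraph G)

  L-share : ∀ {e f} → L e f ≡ true → Σ (Fin n) λ v → inc v e ≡ true × inc v f ≡ true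
  L-share {e} {f} h
    with end₁ e == end₁ f in e₁ | end₁ e == end₂ f in e₂
       | end₂ e == end₁ f in e₃ | end₂ e == end₂ f in e₄
  ... | true | _ | _ | _ = end₁ e , inc-end₁ e , inc-intro f (inj₁ (sym (==⇒≡ e₁)))
  ... | false | true | _ | _ = end₁ e , inc-end₁ e , inc-intro f (inj₂ (sym (==⇒≡ e₂)))
  ... | false | false | true | _ = end₂ e , inc-end₂ e , inc-intro f (inj₁ (sym (==⇒≡ e₃)))
  ... | false | false | false | true = end₂ e , inc-end₂ e , inc-intro f (inj₂ (sym (==⇒≡ e₄)))
  ... | false | false | false | false = ⊥-elim (true≢false (sym h))

  L-intro : ∀ {e f v} → e ≢ f → inc v e ≡ true → inc v f ≡ true → L e f ≡ true
  L-intro {e} {f} ne ie if = ∧-intro (not-intro distinct) (share (inc-elim e ie) (inc-elim f if))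
    where
    e₁f₁ e₁f₂ e₂f₁ e₂f₂ : Bool
    e₁f₁ = end₁ e == end₁ f
    e₁f₂ = end₁ e == end₂ f
    e₂f₁ = end₂ e == end₁ f
    e₂f₂ = end₂ e == end₂ f
    distinct : e₁f₁ ∧ e₂f₂ ≡ false
    distinct = false-intro λ h → ne (edge-ext (==⇒≡ (∧-true₁ h)) (==⇒≡ (∧-true₂ {e₁f₁} h)))
    share : ∀ {v} → end₁ e ≡ v ⊎ end₂ e ≡ v → end₁ f ≡ v ⊎ end₂ f ≡ v →
            e₁f₁ ∨ e₁f₂ ∨ e₂f₁ ∨ e₂f₂ ≡ true
    share (inj₁ x) (inj₁ y) = ∨-introˡ (≡⇒== (trans x (sym y)))
    share (inj₁ x) (inj₂ y) = ∨-introʳ e₁f₁ (∨-introˡ (≡⇒== (trans x (sym y))))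
    share (inj₂ x) (inj₁ y) =
      ∨-introʳ e₁f₁ (∨-introʳ e₁f₂ (∨-introˡ (≡⇒== (trans x (sym y)))))
    share (inj₂ x) (inj₂ y) =
      ∨-introʳ e₁f₁ (∨-introʳ e₁f₂ (∨-introʳ e₂f₁ (≡⇒== (trans x (sym y)))))

  -- Let xy be an edge.  An edge at y avoiding x and an edge at x avoiding y
  -- are not adjacent in L(G): a common vertex would close a triangle.
  crossing-edges-disjoint : ∀ {x y} f g → A x y →
    inc y f ≡ true → inc x f ≡ false → inc x g ≡ true → inc y g ≡ false →
    L f g ≡ true → ⊥
  crossing-edges-disjoint {x} {y} f g xy yf xf xg yg fg
    with L-share {f} {g} fg | other-end f yf | other-end g xg
  ... | q , qf , qg | α , yα , αf | β , xβ , βg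
    with two-ends f yf αf (A-≢ yα) qf | two-ends g xg βg (A-≢ xβ) qg
  ... | inj₁ refl | _ = true≢false (trans (sym qg) yg)
  ... | inj₂ _ | inj₁ refl = true≢false (trans (sym qf) xf)
  ... | inj₂ refl | inj₂ refl = no-triangle xy yα (A-sym xβ)

  -- The stars of internal vertices are exactly
  -- the maximal cliques of H, and two of them meet iff their centres are
  -- adjacent; hence K(H) is the subgraph of G induced by the internal
  -- vertices.
  module Stars {m : ℕ} (H : Graph (Fin m)) (ψ : Iso (LineGraph G) H) where

    toH : E → Fin m
    toH = Iso.to ψ

    toE : Fin m → E
    toE = Iso.from ψ

    toE-toH : ∀ e → toE (toH e) ≡ e
    toE-toH = Iso.from-to ψ

    toE-injective : ∀ {u w} → toE u ≡ toE w → u ≡ w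
    toE-injective {u} {w} e = trans (sym (Iso.to-from ψ u)) (trans (cong toH e) (Iso.to-from ψ w))

    adjH≡L : ∀ u w → adj H u w ≡ L (toE u) (toE w)
    adjH≡L u w =
      sym (trans (Iso.preserve ψ (toE u) (toE w)) (cong₂ (adj H) (Iso.to-from ψ u) (Iso.to-from ψ w)))

    star : Fin n → Subset m
    star v = V.tabulate (λ u → inc v (toE u))

    lookup-star : ∀ v u → V.lookup (star v) u ≡ inc v (toE u)
    lookup-star v u = VP.lookup∘tabulate (λ u → inc v (toE u)) u

    ∈star⇒inc : ∀ {v u} → u ∈ star v → inc v (toE u) ≡ true
    ∈star⇒inc {v} {u} h = trans (sym (lookup-star v u)) (VP.[]=⇒lookup h)

    inc⇒∈star : ∀ {v u} → inc v (toE u) ≡ true → u ∈ star v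
    inc⇒∈star {v} {u} h = VP.lookup⇒[]= u (star v) (trans (lookup-star v u) h)

    edgeAt : ∀ v y → A v y → Fin m
    edgeAt v y vy = toH (mkEdge v y vy)

    edgeAt-inc₁ : ∀ v y vy → inc v (toE (edgeAt v y vy)) ≡ true
    edgeAt-inc₁ v y vy =
      subst (λ e → inc v e ≡ true) (sym (toE-toH (mkEdge v y vy))) (mkEdge-inc₁ v y vy)

    edgeAt-inc₂ : ∀ v y vy → inc y (toE (edgeAt v y vy)) ≡ true
    edgeAt-inc₂ v y vy =
      subst (λ e → inc y e ≡ true) (sym (toE-toH (mkEdge v y vy))) (mkEdge-inc₂ v y vy)

    edgeAt-ends : ∀ {p} v y vy → inc p (toE (edgeAt v y vy)) ≡ true → p ≡ v ⊎ p ≡ y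
    edgeAt-ends {p} v y vy h =
      mkEdge-inc-elim {h = vy} (subst (λ e → inc p e ≡ true) (toE-toH (mkEdge v y vy)) h)

    edgeAt-∈star : ∀ v y vy → edgeAt v y vy ∈ star v
    edgeAt-∈star v y vy = inc⇒∈star (edgeAt-inc₁ v y vy)

    star-clique : ∀ v → IsClique H (star v)
    star-clique v u w hu hw ne =
      trans (adjH≡L u w) (L-intro (λ e → ne (toE-injective e)) (∈star⇒inc hu) (∈star⇒inc hw))

    -- an edge meeting all three edges at an internal vertex v contains v,
    -- since it has only two ends
    star-maximal : ∀ {v} → Internal v → ∀ S → IsClique H S → star v ⊆ S → S ⊆ star v
    star-maximal {v} iv S cl sub {x} hx with inc v (toE x) in vx
    ... | true = inc⇒∈star vx
    ... | false =
      ⊥-elim (no-three-ends (toE x) (meets x₁ p₁) (meets x₂ p₂) (meets x₃ p₃)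
                            x₂≢x₁ x₃≢x₁ x₃≢x₂)
      where
      open Three (neighbours iv)
      meets : ∀ y → A v y → inc y (toE x) ≡ true
      meets y vy
        with L-share {toE u} {toE x}
               (trans (sym (adjH≡L u x)) (cl u x (sub (edgeAt-∈star v y vy)) hx u≢x))
        where
        u : Fin m
        u = edgeAt v y vy
        u≢x : u ≢ x
        u≢x e = true≢false
          (trans (sym (edgeAt-inc₁ v y vy)) (trans (cong (λ z → inc v (toE z)) e) vx))
      ... | p , p∈vy , p∈x with edgeAt-ends v y vy p∈vy
      ... | inj₁ refl = ⊥-elim (true≢false (trans (sym p∈x) vx))
      ... | inj₂ refl = p∈x

    star-⊆⇒≡ : ∀ {v w} → Internal v → star v ⊆ star w → v ≡ w
    star-⊆⇒≡ {v} {w} iv sub with v ≟ w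
    ... | yes e = e
    ... | no ne = ⊥-elim (x₂≢x₁ (trans (is-w x₂ p₂) (sym (is-w x₁ p₁))))
      where
      open Three (neighbours iv)
      is-w : ∀ y → A v y → y ≡ w
      is-w y vy with edgeAt-ends v y vy (∈star⇒inc (sub (edgeAt-∈star v y vy)))
      ... | inj₁ e = ⊥-elim (ne (sym e))
      ... | inj₂ e = sym e

    leaf-star-⊆ : ∀ {z z'} → Leaf z → A z z' → star z ⊆ star z'
    leaf-star-⊆ lz zz' {w} hw with other-end (toE w) (∈star⇒inc hw)
    ... | q , zq , qw =
      inc⇒∈star (subst (λ t → inc t (toE w) ≡ true) (leaf-neighbour-unique lz zz' zq) qw)

    clique-other-end : ∀ {S u w P Q} → IsClique H S → u ∈ S → w ∈ S →
                       inc P (toE u) ≡ true → inc Q (toE u) ≡ true → P ≢ Q →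
                       inc P (toE w) ≡ false → inc Q (toE w) ≡ true
    clique-other-end {u = u} {w} cl u∈S w∈S Pu Qu P≢Q Pw
      with L-share {toE w} {toE u} (trans (sym (adjH≡L w u)) (cl w u w∈S u∈S w≢u))
      where
      w≢u : w ≢ u
      w≢u refl = true≢false (trans (sym Pu) Pw)
    ... | r , rw , ru with two-ends (toE u) Pu Qu P≢Q ru
    ... | inj₁ refl = ⊥-elim (true≢false (trans (sym rw) Pw))
    ... | inj₂ refl = rw

    clique-in-star : ∀ {S} → IsClique H S → ∀ {u} → u ∈ S →
                     S ⊆ star (end₁ (toE u)) ⊎ S ⊆ star (end₂ (toE u))
    clique-in-star {S} cl {u} u∈S
      with FP.any? (λ w → (w SP.∈? S) ×-dec (inc x (toE w) BP.≟ false))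
      where
      x : Fin n
      x = end₁ (toE u)
    ... | no none = inj₁ S⊆star-x
      where
      S⊆star-x : S ⊆ star (end₁ (toE u))
      S⊆star-x {w} w∈S with inc (end₁ (toE u)) (toE w) in xw
      ... | true = inc⇒∈star xw
      ... | false = ⊥-elim (none (w , w∈S , xw))
    ... | yes (u₁ , u₁∈S , xu₁) = inj₂ S⊆star-y
      where
      e : E
      e = toE u
      x y : Fin n
      x = end₁ e
      y = end₂ e
      yu₁ : inc y (toE u₁) ≡ true
      yu₁ = clique-other-end cl u∈S u₁∈S (inc-end₁ e) (inc-end₂ e) (A-≢ (ends-adj e)) xu₁
      S⊆star-y : S ⊆ star y
      S⊆star-y {w} w∈S with inc y (toE w) in yw
      ... | true = inc⇒∈star yw
      ... | false = ⊥-elim (crossing-edges-disjoint (toE u₁) (toE w) (ends-adj e) yu₁ xu₁ xw yw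
                              (trans (sym (adjH≡L u₁ w)) (cl u₁ w u₁∈S w∈S u₁≢w)))
        where
        xw : inc x (toE w) ≡ true
        xw = clique-other-end cl u∈S w∈S (inc-end₂ e) (inc-end₁ e)
                              (λ y≡x → A-≢ (ends-adj e) (sym y≡x)) yw
        u₁≢w : u₁ ≢ w
        u₁≢w refl = true≢false (trans (sym xw) xu₁)

    maximal⊆star : ∀ {S} → IsMaxClique H S → ∀ {z z'} → A z z' → S ⊆ star z →
                   Internal z × S ≡ star z
    maximal⊆star (cl , max) {z} {z'} zz' S⊆ with degs z
    ... | inj₂ iz = iz , SP.⊆-antisym S⊆ (max (star z) (star-clique z) S⊆)
    ... | inj₁ lz = ⊥-elim (A-≢ zz' (sym (star-⊆⇒≡ iz' star-z'⊆star-z)))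
      where
      iz' : Internal z'
      iz' = subst Internal (sym (leaf-neighbour-unique lz (nbr-adj lz) zz')) (nbr-internal lz)
      star-z'⊆star-z : star z' ⊆ star z
      star-z'⊆star-z h =
        S⊆ (max (star z') (star-clique z') (λ h' → leaf-star-⊆ lz zz' (S⊆ h')) h)

    maximal-clique-inhabited : ∀ {S} → IsMaxClique H S → Σ (Fin m) λ u → u ∈ S
    maximal-clique-inhabited {S} (cl , max) with SP.nonempty? S
    ... | yes inhabited = inhabited
    ... | no empty =
      ⊥-elim (empty (u₀ , max ⁅ u₀ ⁆ singleton-clique S⊆⁅u₀⁆ (SP.x∈⁅x⁆ u₀)))
      where
      open Three (neighbours v₀-internal)
      u₀ : Fin m
      u₀ = edgeAt v₀ x₁ p₁
      singleton-clique : IsClique H ⁅ u₀ ⁆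
      singleton-clique u w hu hw ne =
        ⊥-elim (ne (trans (SP.x∈⁅y⁆⇒x≡y u₀ hu) (sym (SP.x∈⁅y⁆⇒x≡y u₀ hw))))
      S⊆⁅u₀⁆ : S ⊆ ⁅ u₀ ⁆
      S⊆⁅u₀⁆ {x} hx = ⊥-elim (empty (x , hx))

    maximal-clique-is-star : ∀ S → IsMaxClique H S → Σ (Fin n) λ z → Internal z × S ≡ star z
    maximal-clique-is-star S mc with maximal-clique-inhabited mc
    ... | u , u∈S with clique-in-star (proj₁ mc) u∈S
    ... | inj₁ S⊆ = end₁ (toE u) , maximal⊆star mc (ends-adj (toE u)) S⊆
    ... | inj₂ S⊆ = end₂ (toE u) , maximal⊆star mc (A-sym (ends-adj (toE u))) S⊆

    starClique : (v : Fin n) → .(Internal v) → MaxClique H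
    starClique v iv = maxClique (star v) (star-clique v , star-maximal iv)

    starClique-cong : ∀ {v w} → v ≡ w → .(iv : Internal v) .(iw : Internal w) →
                      starClique v iv ≡ starClique w iw
    starClique-cong refl _ _ = refl

    centre : (C : MaxClique H) → Σ (Fin n) λ z → Internal z × MaxClique.set C ≡ star z
    centre (maxClique S mc) =
      recompute (FP.any? (λ z → (deg G z N.≟ 3) ×-dec (VP.≡-dec BP._≟_ S (star z))))
                (maximal-clique-is-star S mc)

    maxClique-ext : ∀ {C D : MaxClique H} → MaxClique.set C ≡ MaxClique.set D → C ≡ D
    maxClique-ext {maxClique S _} {maxClique .S _} refl = refl

    stars-meet : Fin n → Fin n → Bool
    stars-meet v w = anyF (λ i → V.lookup (star v) i ∧ V.lookup (star w) i)

    stars-meet≡adj : ∀ v w → v ≢ w → stars-meet v w ≡ adj G v w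
    stars-meet≡adj v w v≢w = bool-ext meet⇒adj adj⇒meet
      where
      meet⇒adj : stars-meet v w ≡ true → A v w
      meet⇒adj h with anyF-elim _ h
      ... | i , hi = inc-both-adj (toE i) (trans (sym (lookup-star v i)) (∧-true₁ hi))
                       (trans (sym (lookup-star w i)) (∧-true₂ {V.lookup (star v) i} hi)) v≢w
      adj⇒meet : A v w → stars-meet v w ≡ true
      adj⇒meet vw = anyF-intro _ (edgeAt v w vw)
        (∧-intro (trans (lookup-star v _) (edgeAt-inc₁ v w vw))
                 (trans (lookup-star w _) (edgeAt-inc₂ v w vw)))

    clique-graph-adj : ∀ v w (iv : Internal v) (iw : Internal w) →
                       adj (CliqueGraph H) (starClique v iv) (starClique w iw) ≡ adj G v w
    clique-graph-adj v w iv iw with v ≟ w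
    ... | yes refl with VP.≡-dec BP._≟_ (star v) (star v)
    ...   | yes _ = sym (irrA v)
    ...   | no q = ⊥-elim (q refl)
    clique-graph-adj v w iv iw | no v≢w with VP.≡-dec BP._≟_ (star v) (star w)
    ...   | yes eq = ⊥-elim (v≢w (star-⊆⇒≡ iv (λ h → subst (_ ∈_) eq h)))
    ...   | no _ = stars-meet≡adj v w v≢w

    module PathOfCentres {K : ℕ} (χ : Iso (CliqueGraph H) (PathGraph K)) where

      c : Fin K → Fin n
      c i = proj₁ (centre (Iso.from χ i))

      c-internal : ∀ i → Internal (c i)
      c-internal i = proj₁ (proj₂ (centre (Iso.from χ i)))

      starClique-c : ∀ i → starClique (c i) (c-internal i) ≡ Iso.from χ i
      starClique-c i = maxClique-ext (sym (proj₂ (proj₂ (centre (Iso.from χ i)))))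

      c-injective : ∀ {i j} → c i ≡ c j → i ≡ j
      c-injective {i} {j} e = begin
        i                                          ≡⟨ Iso.to-from χ i ⟨
        Iso.to χ (Iso.from χ i)                    ≡⟨ cong (Iso.to χ) (starClique-c i) ⟨
        Iso.to χ (starClique (c i) (c-internal i))
          ≡⟨ cong (Iso.to χ) (starClique-cong e (c-internal i) (c-internal j)) ⟩
        Iso.to χ (starClique (c j) (c-internal j)) ≡⟨ cong (Iso.to χ) (starClique-c j) ⟩
        Iso.to χ (Iso.from χ j)                    ≡⟨ Iso.to-from χ j ⟩
        j                                          ∎
        where open ≡-Reasoning

      c-onto : ∀ v → Internal v → Σ (Fin K) λ i → c i ≡ v
      c-onto v iv = i , sym (star-⊆⇒≡ iv (λ h → subst (_ ∈_) same-star h))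
        where
        i = Iso.to χ (starClique v iv)
        same-star : star v ≡ star (c i)
        same-star = trans (cong MaxClique.set (sym (Iso.from-to χ (starClique v iv))))
                          (proj₂ (proj₂ (centre (Iso.from χ i))))

      c-path : ∀ i j → adj G (c i) (c j) ≡ adj (PathGraph K) i j
      c-path i j = begin
        adj G (c i) (c j)
          ≡⟨ clique-graph-adj (c i) (c j) (c-internal i) (c-internal j) ⟨
        adj (CliqueGraph H) (starClique (c i) (c-internal i)) (starClique (c j) (c-internal j))
          ≡⟨ cong₂ (adj (CliqueGraph H)) (starClique-c i) (starClique-c j) ⟩
        adj (CliqueGraph H) (Iso.from χ i) (Iso.from χ j)
          ≡⟨ Iso.preserve χ (Iso.from χ i) (Iso.from χ j) ⟩
        adj (PathGraph K) (Iso.to χ (Iso.from χ i)) (Iso.to χ (Iso.from χ j))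
          ≡⟨ cong₂ (adj (PathGraph K)) (Iso.to-from χ i) (Iso.to-from χ j) ⟩
        adj (PathGraph K) i j
          ∎
        where open ≡-Reasoning

  -- Put c i at spine vertex i+1 of
  -- Centipede (K+2) and each leaf at a free slot of its neighbour c i: the
  -- spine start (if i = 0, for the first leaf of c i), the spine end (if
  -- i = K-1, for the second leaf of c i), and the pendant of c i otherwise.
  -- This is an adjacency-preserving injection, and a bijection once
  -- 2K + 2 ≤ n.
  module Spine {K : ℕ} (c : Fin K → Fin n) (c-internal : ∀ i → Internal (c i))
    (c-injective : ∀ {i j} → c i ≡ c j → i ≡ j)
    (c-onto : ∀ v → Internal v → Σ (Fin K) λ i → c i ≡ v)
    (c-path : ∀ i j → adj G (c i) (c j) ≡ adj (PathGraph K) i j) where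

    index : ∀ v → Internal v → Fin K
    index v iv = proj₁ (c-onto v iv)

    c-index : ∀ v iv → c (index v iv) ≡ v
    c-index v iv = proj₂ (c-onto v iv)

    index-cong : ∀ {v w} (iv : Internal v) (iw : Internal w) → v ≡ w → index v iv ≡ index w iw
    index-cong {v} {w} iv iw e = c-injective (trans (c-index v iv) (trans e (sym (c-index w iw))))

    index-injective : ∀ {v w} (iv : Internal v) (iw : Internal w) →
                      index v iv ≡ index w iw → v ≡ w
    index-injective {v} {w} iv iw e = trans (sym (c-index v iv)) (trans (cong c e) (c-index w iw))

    internal-count : K N.≤ numDeg G 3
    internal-count = subst (K N.≤_) (sym (countF≡count (λ v → deg G v ≡ᵇ 3)))
      (count-injective (λ v → deg G v ≡ᵇ 3) c c-injective (λ i → ≡⇒≡ᵇ (c-internal i)))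

    path-adj : ∀ {w} (iw : Internal w) j → adj (PathGraph K) (index w iw) j ≡ true → A w (c j)
    path-adj {w} iw j h =
      subst (λ v → A v (c j)) (c-index w iw) (trans (c-path (index w iw) j) h)

    W : Set
    W = Fin (2 + K) ⊎ Fin K

    adjW : W → W → Bool
    adjW = adj (Centipede (2 + K))

    adjW-sym : ∀ x y → adjW x y ≡ adjW y x
    adjW-sym (inj₁ i) (inj₁ j) = BP.∨-comm (suc (toℕ i) ≡ᵇ toℕ j) (suc (toℕ j) ≡ᵇ toℕ i)
    adjW-sym (inj₁ i) (inj₂ j) = refl
    adjW-sym (inj₂ j) (inj₁ i) = refl
    adjW-sym (inj₂ i) (inj₂ j) = refl

    spine : Fin K → W
    spine i = inj₁ (F.suc (inject₁ i))

    spineStart spineEnd : W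
    spineStart = inj₁ F.zero
    spineEnd = inj₁ (fromℕ (suc K))

    spine-adj : ∀ i j → adjW (spine i) (spine j) ≡ adj (PathGraph K) i j
    spine-adj i j rewrite FP.toℕ-inject₁ i | FP.toℕ-inject₁ j = refl

    leafNbr : Fin n → Fin n → Bool
    leafNbr w x = adj G w x ∧ (deg G x ≡ᵇ 1)

    leafNbr-intro : ∀ {w x} → A w x → Leaf x → leafNbr w x ≡ true
    leafNbr-intro wx lx = ∧-intro wx (≡⇒≡ᵇ lx)

    leafNbr-adj : ∀ {w x} → leafNbr w x ≡ true → A w x
    leafNbr-adj h = ∧-true₁ h

    leafNbr-leaf : ∀ {w x} → leafNbr w x ≡ true → Leaf x
    leafNbr-leaf {w} h = ≡ᵇ⇒≡ (∧-true₂ {adj G w _} h)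

    firstLeaf secondLeaf : Fin n → Fin n
    firstLeaf w = pick (leafNbr w) w
    secondLeaf w = pick (remove (leafNbr w) (firstLeaf w)) w

    atStart atEnd : Fin n → Fin K → Fin n → Bool
    atStart w i u = (toℕ i ≡ᵇ 0) ∧ (firstLeaf w == u)
    atEnd w i u = (suc (toℕ i) ≡ᵇ K) ∧ (secondLeaf w == u)

    leafSlot : Fin n → Fin K → Fin n → W
    leafSlot w i u =
      if atStart w i u then spineStart else (if atEnd w i u then spineEnd else inj₂ i)

    data Slot (w : Fin n) (i : Fin K) (u : Fin n) : Set where
      start   : leafSlot w i u ≡ spineStart → toℕ i ≡ 0 → firstLeaf w ≡ u → Slot w i u
      end     : leafSlot w i u ≡ spineEnd → suc (toℕ i) ≡ K → secondLeaf w ≡ u → Slot w i u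
      pendant : leafSlot w i u ≡ inj₂ i → atStart w i u ≡ false → atEnd w i u ≡ false →
                Slot w i u

    slot : ∀ w i u → Slot w i u
    slot w i u with atStart w i u in s
    ... | true =
      start (if-true _ _ s) (≡ᵇ⇒≡ (∧-true₁ s)) (==⇒≡ (∧-true₂ {toℕ i ≡ᵇ 0} s))
    ... | false with atEnd w i u in t
    ...   | true = end (trans (if-false _ _ s) (if-true _ _ t)) (≡ᵇ⇒≡ (∧-true₁ t))
                       (==⇒≡ (∧-true₂ {suc (toℕ i) ≡ᵇ K} t))
    ...   | false = pendant (trans (if-false _ _ s) (if-false _ _ t)) s t

    data LeafPosition (x : W) : Set where
      at-start   : x ≡ spineStart → LeafPosition x
      at-end     : x ≡ spineEnd → LeafPosition x
      at-pendant : ∀ i → x ≡ inj₂ i → LeafPosition x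

    slot-position : ∀ w i u → LeafPosition (leafSlot w i u)
    slot-position w i u with slot w i u
    ... | start e _ _ = at-start e
    ... | end e _ _ = at-end e
    ... | pendant e _ _ = at-pendant i e

    spine-not-leaf-position : ∀ j → ¬ LeafPosition (spine j)
    spine-not-leaf-position j (at-start ())
    spine-not-leaf-position j (at-end e) =
      NP.<-irrefl j≡K (FP.toℕ<n j)
      where
      j≡K : toℕ j ≡ K
      j≡K = trans (sym (FP.toℕ-inject₁ j))
                  (NP.suc-injective (trans (cong toℕ (inj₁-injective e)) (FP.toℕ-fromℕ (suc K))))
    spine-not-leaf-position j (at-pendant i ())

    0≢K : Fin K → 0 ≢ K
    0≢K k e = NP.n≮0 (subst (toℕ k N.<_) (sym e) (FP.toℕ<n k))

    -- the leaf positions are pairwise non-adjacent (as K ≥ 1)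
    leaf-positions-nonadjacent : Fin K → ∀ {x y} → LeafPosition x → LeafPosition y →
                                 adjW x y ≡ false
    leaf-positions-nonadjacent k (at-start refl) (at-start refl) = refl
    leaf-positions-nonadjacent k (at-start refl) (at-end refl) rewrite FP.toℕ-fromℕ K =
      cong (_∨ false) (≢⇒≡ᵇ (0≢K k))
    leaf-positions-nonadjacent k (at-start refl) (at-pendant i refl) = refl
    leaf-positions-nonadjacent k (at-end refl) (at-start refl) rewrite FP.toℕ-fromℕ K =
      ≢⇒≡ᵇ (0≢K k)
    leaf-positions-nonadjacent k (at-end refl) (at-end refl) rewrite FP.toℕ-fromℕ K =
      cong (λ b → b ∨ b) (≢⇒≡ᵇ {suc K} NP.1+n≢n)
    leaf-positions-nonadjacent k (at-end refl) (at-pendant i refl) rewrite FP.toℕ-fromℕ K =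
      ≢⇒≡ᵇ (λ e → NP.<-irrefl (sym e) (FP.toℕ<n i))
    leaf-positions-nonadjacent k (at-pendant i refl) (at-start refl) = refl
    leaf-positions-nonadjacent k (at-pendant i refl) (at-end refl) rewrite FP.toℕ-fromℕ K =
      ≢⇒≡ᵇ (λ e → NP.<-irrefl (sym e) (FP.toℕ<n i))
    leaf-positions-nonadjacent k (at-pendant i refl) (at-pendant j refl) = refl

    spine-slot-adj : ∀ j w i u → adjW (spine j) (leafSlot w i u) ≡ (toℕ j ≡ᵇ toℕ i)
    spine-slot-adj j w i u with slot w i u
    ... | start e i≡0 _ rewrite e | FP.toℕ-inject₁ j | i≡0 = ≡ᵇ-sym 0 (toℕ j)
    ... | end e i+1≡K _ rewrite e | FP.toℕ-inject₁ j | FP.toℕ-fromℕ K =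
      trans (cong (_∨ (suc K ≡ᵇ toℕ j)) (cong (suc (toℕ j) ≡ᵇ_) (sym i+1≡K)))
            (trans (cong ((toℕ j ≡ᵇ toℕ i) ∨_) (≢⇒≡ᵇ j≢1+K)) (BP.∨-identityʳ _))
      where
      j≢1+K : suc K ≢ toℕ j
      j≢1+K e = NP.<-irrefl (sym e) (NP.<-trans (FP.toℕ<n j) (NP.n<1+n K))
    ... | pendant e _ _ rewrite e | FP.toℕ-inject₁ j = refl

    internal-leaf-adj : ∀ u v (iu : Internal u) (lv : Leaf v) →
      adj G u v ≡ (toℕ (index u iu) ≡ᵇ toℕ (index (nbr v) (nbr-internal lv)))
    internal-leaf-adj u v iu lv = bool-ext adj⇒same same⇒adj
      where
      adj⇒same : A u v → _
      adj⇒same uv = ≡⇒≡ᵇ (cong toℕ (index-cong iu (nbr-internal lv)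
                                      (leaf-neighbour-unique lv (nbr-adj lv) (A-sym uv))))
      same⇒adj : _ → A u v
      same⇒adj h = subst (λ t → A t v)
        (sym (index-injective iu (nbr-internal lv) (FP.toℕ-injective (≡ᵇ⇒≡ h))))
        (A-sym (nbr-adj lv))

    predecessor : (i : Fin K) → toℕ i ≢ 0 → Σ (Fin K) λ j → suc (toℕ j) ≡ toℕ i
    predecessor F.zero i≢0 = ⊥-elim (i≢0 refl)
    predecessor (F.suc i) _ = inject₁ i , cong suc (FP.toℕ-inject₁ i)

    successor : (i : Fin K) → suc (toℕ i) ≢ K → Σ (Fin K) λ j → toℕ j ≡ suc (toℕ i)
    successor i i+1≢K = F.fromℕ< i+1<K , FP.toℕ-fromℕ< i+1<K
      where
      i+1<K : suc (toℕ i) N.< K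
      i+1<K = NP.≤∧≢⇒< (FP.toℕ<n i) i+1≢K

    -- Besides its pendant slot, w = c i has two further neighbours: towards
    -- the spine start c (i-1), or its first leaf if i = 0 ...
    data LeftFlank (w : Fin n) (i : Fin K) (ℓ : Fin n) : Set where
      first-leaf : toℕ i ≡ 0 → ℓ ≡ firstLeaf w → Leaf ℓ → LeftFlank w i ℓ
      previous   : ∀ j → suc (toℕ j) ≡ toℕ i → ℓ ≡ c j → LeftFlank w i ℓ

    -- ... and towards the spine end c (i+1), or its second leaf if i = K-1
    data RightFlank (w : Fin n) (i : Fin K) (r : Fin n) : Set where
      second-leaf : suc (toℕ i) ≡ K → r ≡ secondLeaf w → Leaf r → r ≢ firstLeaf w →
                    RightFlank w i r
      next        : ∀ j → toℕ j ≡ suc (toℕ i) → r ≡ c j → RightFlank w i r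

    left-flank : ∀ {w u} (iw : Internal w) → A w u → Leaf u →
                 Σ (Fin n) λ ℓ → A w ℓ × LeftFlank w (index w iw) ℓ
    left-flank {w} iw wu lu with toℕ (index w iw) N.≟ 0
    ... | yes i≡0 = firstLeaf w , leafNbr-adj found , first-leaf i≡0 refl (leafNbr-leaf found)
      where
      found : leafNbr w (firstLeaf w) ≡ true
      found = pick-spec (leafNbr w) w (leafNbr-intro wu lu)
    ... | no i≢0 with predecessor (index w iw) i≢0
    ...   | j , j+1≡i =
      c j , path-adj iw j (∨-introʳ (suc (toℕ (index w iw)) ≡ᵇ toℕ j) (≡⇒≡ᵇ j+1≡i)) ,
      previous j j+1≡i refl

    right-flank : ∀ {w u v} (iw : Internal w) → A w u → Leaf u → A w v → Leaf v → u ≢ v →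
                  Σ (Fin n) λ r → A w r × RightFlank w (index w iw) r
    right-flank {w} {u} {v} iw wu lu wv lv u≢v with suc (toℕ (index w iw)) N.≟ K
    ... | yes last = secondLeaf w , leafNbr-adj second-is-leafNbr ,
                     second-leaf last refl (leafNbr-leaf second-is-leafNbr) (remove-≢ (leafNbr w) found)
      where
      another : Σ (Fin n) λ x → remove (leafNbr w) (firstLeaf w) x ≡ true
      another with u ≟ firstLeaf w
      ... | no u≢first = u , remove-keeps (leafNbr w) (leafNbr-intro wu lu) u≢first
      ... | yes refl = v , remove-keeps (leafNbr w) (leafNbr-intro wv lv) (λ e → u≢v (sym e))
      found : remove (leafNbr w) (firstLeaf w) (secondLeaf w) ≡ true
      found = pick-spec (remove (leafNbr w) (firstLeaf w)) w (proj₂ another)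
      second-is-leafNbr : leafNbr w (secondLeaf w) ≡ true
      second-is-leafNbr = remove-⊆ (leafNbr w) found
    ... | no not-last with successor (index w iw) not-last
    ...   | j , j≡i+1 =
      c j , path-adj iw j (∨-introˡ (≡⇒≡ᵇ (sym j≡i+1))) , next j j≡i+1 refl

    flanks-distinct : ∀ {w i ℓ r} → LeftFlank w i ℓ → RightFlank w i r → r ≢ ℓ
    flanks-distinct (first-leaf _ refl _) (second-leaf _ refl _ r≢first) = r≢first
    flanks-distinct (first-leaf _ refl lℓ) (next j _ refl) e = leaf≢internal lℓ (c-internal j) (sym e)
    flanks-distinct (previous j _ refl) (second-leaf _ refl lr _) e = leaf≢internal lr (c-internal j) e
    flanks-distinct (previous j j+1≡i refl) (next j' j'≡i+1 refl) e =
      NP.m+1+n≢n 1 (trans (sym (trans j'≡i+1 (cong suc (sym j+1≡i)))) (cong toℕ (c-injective e)))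

    record Pendant (w : Fin n) (iw : Internal w) (u : Fin n) : Set where
      field
        adjacent  : A w u
        leaf      : Leaf u
        not-start : atStart w (index w iw) u ≡ false
        not-end   : atEnd w (index w iw) u ≡ false
    open Pendant

    left-not-pendant : ∀ {w iw ℓ u} → LeftFlank w (index w iw) ℓ → Pendant w iw u → u ≢ ℓ
    left-not-pendant (first-leaf i≡0 refl _) p e =
      ==⇒≢ (∧-false₂ (≡⇒≡ᵇ i≡0) (not-start p)) (sym e)
    left-not-pendant (previous j _ refl) p = leaf≢internal (leaf p) (c-internal j)

    right-not-pendant : ∀ {w iw r u} → RightFlank w (index w iw) r → Pendant w iw u → u ≢ r
    right-not-pendant (second-leaf last refl _ _) p e =
      ==⇒≢ (∧-false₂ (≡⇒≡ᵇ last) (not-end p)) (sym e)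
    right-not-pendant (next j _ refl) p = leaf≢internal (leaf p) (c-internal j)

    -- hence, having only three neighbours, w has at most one pendant leaf
    one-pendant : ∀ {w u v} (iw : Internal w) → Pendant w iw u → Pendant w iw v → u ≡ v
    one-pendant {w} {u} {v} iw pu pv with u ≟ v
    ... | yes u≡v = u≡v
    ... | no u≢v with left-flank iw (adjacent pu) (leaf pu)
                    | right-flank iw (adjacent pu) (leaf pu) (adjacent pv) (leaf pv) u≢v
    ...   | ℓ , wℓ , left | r , wr , right =
      ⊥-elim (no-four-neighbours iw (adjacent pu) (adjacent pv) wℓ wr (λ e → u≢v (sym e))
               (λ e → left-not-pendant left pu (sym e)) (λ e → left-not-pendant left pv (sym e))
               (λ e → right-not-pendant right pu (sym e)) (λ e → right-not-pendant right pv (sym e))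
               (flanks-distinct left right))

    leafIndex : ∀ {u} → Leaf u → Fin K
    leafIndex {u} lu = index (nbr u) (nbr-internal lu)

    leafPlace : ∀ u → Leaf u → W
    leafPlace u lu = leafSlot (nbr u) (leafIndex lu) u

    place : (u : Fin n) → Dec (Internal u) → W
    place u (yes iu) = spine (index u iu)
    place u (no ni) = leafPlace u (leaf-if-not-internal ni)

    embed : Fin n → W
    embed u = place u (deg G u N.≟ 3)

    index-path : ∀ {u v} (iu : Internal u) (iv : Internal v) →
                 adj G u v ≡ adj (PathGraph K) (index u iu) (index v iv)
    index-path {u} {v} iu iv =
      trans (cong₂ (adj G) (sym (c-index u iu)) (sym (c-index v iv))) (c-path (index u iu) (index v iv))

    place-preserves : ∀ u v (du : Dec (Internal u)) (dv : Dec (Internal v)) →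
                      adj G u v ≡ adjW (place u du) (place v dv)
    place-preserves u v (yes iu) (yes iv) =
      trans (index-path iu iv) (sym (spine-adj (index u iu) (index v iv)))
    place-preserves u v (yes iu) (no nv) =
      trans (internal-leaf-adj u v iu lv) (sym (spine-slot-adj (index u iu) (nbr v) (leafIndex lv) v))
      where
      lv : Leaf v
      lv = leaf-if-not-internal nv
    place-preserves u v (no nu) (yes iv) =
      trans (symA u v) (trans (internal-leaf-adj v u iv lu)
        (trans (sym (spine-slot-adj (index v iv) (nbr u) (leafIndex lu) u))
               (adjW-sym (spine (index v iv)) (leafPlace u lu))))
      where
      lu : Leaf u
      lu = leaf-if-not-internal nu
    place-preserves u v (no nu) (no nv) =
      trans (false-intro (no-leaf-edge lu lv))
            (sym (leaf-positions-nonadjacent (leafIndex lu) (slot-position (nbr u) (leafIndex lu) u)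
                                                            (slot-position (nbr v) (leafIndex lv) v)))
      where
      lu : Leaf u
      lu = leaf-if-not-internal nu
      lv : Leaf v
      lv = leaf-if-not-internal nv

    start≢end : spineStart ≢ spineEnd
    start≢end ()

    start≢pendant : ∀ {i} → spineStart ≢ inj₂ i
    start≢pendant ()

    end≢pendant : ∀ {i} → spineEnd ≢ inj₂ i
    end≢pendant ()

    pendants-coincide : ∀ {u v} (lu : Leaf u) (lv : Leaf v) → leafIndex lu ≡ leafIndex lv →
      atStart (nbr u) (leafIndex lu) u ≡ false → atEnd (nbr u) (leafIndex lu) u ≡ false →
      atStart (nbr v) (leafIndex lv) v ≡ false → atEnd (nbr v) (leafIndex lv) v ≡ false → u ≡ v
    pendants-coincide {u} {v} lu lv same-index su tu sv tv = one-pendant (nbr-internal lu) pu pv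
      where
      same-nbr : nbr u ≡ nbr v
      same-nbr = index-injective (nbr-internal lu) (nbr-internal lv) same-index
      pu : Pendant (nbr u) (nbr-internal lu) u
      pu = record { adjacent = A-sym (nbr-adj lu) ; leaf = lu ; not-start = su ; not-end = tu }
      pv : Pendant (nbr u) (nbr-internal lu) v
      pv = record
        { adjacent = subst (λ w → A w v) (sym same-nbr) (A-sym (nbr-adj lv)) ; leaf = lv
        ; not-start = trans (cong₂ (λ w i → atStart w i v) same-nbr same-index) sv
        ; not-end = trans (cong₂ (λ w i → atEnd w i v) same-nbr same-index) tv }

    leafPlace-injective : ∀ {u v} (lu : Leaf u) (lv : Leaf v) →
                          leafPlace u lu ≡ leafPlace v lv → u ≡ v
    leafPlace-injective {u} {v} lu lv e
      with slot (nbr u) (leafIndex lu) u | slot (nbr v) (leafIndex lv) v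
    ... | start _ iu≡0 first≡u | start _ iv≡0 first≡v =
      trans (sym first≡u) (trans (cong firstLeaf same-nbr) first≡v)
      where
      same-nbr : nbr u ≡ nbr v
      same-nbr = index-injective (nbr-internal lu) (nbr-internal lv)
                   (FP.toℕ-injective (trans iu≡0 (sym iv≡0)))
    ... | end _ iu-last second≡u | end _ iv-last second≡v =
      trans (sym second≡u) (trans (cong secondLeaf same-nbr) second≡v)
      where
      same-nbr : nbr u ≡ nbr v
      same-nbr = index-injective (nbr-internal lu) (nbr-internal lv)
                   (FP.toℕ-injective (NP.suc-injective (trans iu-last (sym iv-last))))
    ... | pendant eu su tu | pendant ev sv tv =
      pendants-coincide lu lv (inj₂-injective (trans (sym eu) (trans e ev))) su tu sv tv
    ... | start eu _ _ | end ev _ _ = ⊥-elim (start≢end (trans (sym eu) (trans e ev)))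
    ... | start eu _ _ | pendant ev _ _ = ⊥-elim (start≢pendant (trans (sym eu) (trans e ev)))
    ... | end eu _ _ | start ev _ _ = ⊥-elim (start≢end (sym (trans (sym eu) (trans e ev))))
    ... | end eu _ _ | pendant ev _ _ = ⊥-elim (end≢pendant (trans (sym eu) (trans e ev)))
    ... | pendant eu _ _ | start ev _ _ = ⊥-elim (start≢pendant (sym (trans (sym eu) (trans e ev))))
    ... | pendant eu _ _ | end ev _ _ = ⊥-elim (end≢pendant (sym (trans (sym eu) (trans e ev))))

    place-injective : ∀ u v (du : Dec (Internal u)) (dv : Dec (Internal v)) →
                      place u du ≡ place v dv → u ≡ v
    place-injective u v (yes iu) (yes iv) e =
      index-injective iu iv (FP.inject₁-injective (FP.suc-injective (inj₁-injective e)))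
    place-injective u v (yes iu) (no nv) e = ⊥-elim (spine-not-leaf-position (index u iu)
      (subst LeafPosition (sym e) (slot-position (nbr v) (leafIndex lv) v)))
      where
      lv : Leaf v
      lv = leaf-if-not-internal nv
    place-injective u v (no nu) (yes iv) e = ⊥-elim (spine-not-leaf-position (index v iv)
      (subst LeafPosition e (slot-position (nbr u) (leafIndex lu) u)))
      where
      lu : Leaf u
      lu = leaf-if-not-internal nu
    place-injective u v (no nu) (no nv) e = leafPlace-injective _ _ e

    centipede-iso : 2 * numDeg G 3 + 2 ≡ n → Iso G (Centipede (2 + K))
    centipede-iso e3 = injection⇒iso G (Centipede (2 + K)) embed
      (λ {u} {v} → place-injective u v (deg G u N.≟ 3) (deg G v N.≟ 3)) size
      (λ u v → place-preserves u v (deg G u N.≟ 3) (deg G v N.≟ 3))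
      where
      open +-*-Solver
      2+d+d : ∀ d → (2 + d) + d ≡ 2 * d + 2
      2+d+d = solve 1 (λ d → (con 2 :+ d) :+ d := con 2 :* d :+ con 2) refl
      size : (2 + K) + K N.≤ n
      size = subst ((2 + K) + K N.≤_) (trans (2+d+d (numDeg G 3)) e3)
                   (NP.+-mono-≤ (s≤s (s≤s internal-count)) internal-count)

degree-3-vertex : ∀ {n} (G : Graph (Fin n)) → numDeg G 3 ≡ 0 ⊎ Σ (Fin n) λ v → deg G v ≡ 3
degree-3-vertex G with numDeg G 3 in d3
... | zero = inj₁ refl
... | suc _ = inj₂ (proj₁ witness , ≡ᵇ⇒≡ (proj₂ witness))
  where
  deg3 : Fin _ → Bool
  deg3 v = deg G v ≡ᵇ 3
  witness : Σ (Fin _) λ v → deg3 v ≡ true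
  witness = count-witness deg3 (trans (sym (countF≡count deg3)) d3)

proposition4 : (n : ℕ) (G : Graph (Fin n)) → IsTree G →
    2 * numDeg G 3 + 2 ≡ n → 2 * numDeg G 1 ≡ n + 2 →
    (k m : ℕ) (H : Graph (Fin m)) → InT H →
    Iso (CliqueGraph H) (PathGraph k) →
    Iso (LineGraph G) H →
    IsCentipede G
proposition4 n G ((symA , irrA) , conn , acyc) e3 e1 k m H _ χ ψ with degree-3-vertex G
... | inj₁ no-internal = two-vertices (trans (sym e3) (cong (λ d → 2 * d + 2) no-internal))
  where
  two-vertices : n ≡ 2 → IsCentipede G
  two-vertices refl = two-vertex-centipede G (symA , irrA) conn
... | inj₂ (v₀ , v₀-internal) = 2 + k , centipede-iso e3
  where
  open Tree G symA irrA conn acyc (degree-1-or-3 G e3 e1) v₀ v₀-internal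
  open Stars H ψ
  open PathOfCentres χ
  open Spine c c-internal c-injective c-onto c-path
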